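{- Let $c$ be a positive integer and $\mu$ a $c$-core. If $\lambda\in\operatorname{Par}^c_{\mu}$ and $G_c(\lambda)=(\xi,\nu)$, then $\nu\in\operatorname{Par}^c_{\mu}$.
   Context: For a partition $\lambda$ and positive integer $d$, $m_d(\lambda)$ is the number of parts equal to $d$. The map $G_c$ sends a partition $\lambda$ to the pair of partitions $(\xi,\nu)$ determined by $m_d(\xi)=\lfloor m_d(\lambda)/c\rfloor$ and $m_d(\nu)=m_d(\lambda)-c\lfloor m_d(\lambda)/c\rfloor$ for all $d\ge1$. A rimhook of length $c$ is a connected set of $c$ boxes of a Young diagram containing no $2\times2$ square whose removal leaves a partition diagram; a $c$-core is a partition with no such rimhook, and the $c$-core of $\lambda$ is obtained by repeatedly removing rimhooks of length $c$ (well defined). $\operatorname{Par}^c_\mu$ is the set of partitions with $c$-core $\mu$. -}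

module Defs where

open import Data.Nat using (ℕ; zero; suc; _+_; _≤_; _<_; _≥_; _∸_; _≟_)
open import Data.Nat.DivMod using (_/_; _%_)
open import Data.List using (List; []; _∷_; length; filter)
open import Data.Nat.ListAction using (sum)
open import Data.List.Relation.Unary.All using (All)
open import Data.List.Relation.Unary.Linked using (Linked)
open import Data.Product using (_×_; Σ; ∃; _,_)
open import Data.Sum using (_⊎_)
open import Relation.Binary.PropositionalEquality using (_≡_)
open import Relation.Binary.Construct.Closure.ReflexiveTransitive using (Star)
open import Relation.Nullary using (¬_)

IsPartition : List ℕ → Set
IsPartition l = Linked _≥_ l × All (λ x → 0 < x) l

-- i-th part (0-indexed), equal to 0 beyond the length.
part : List ℕ → ℕ → ℕ
part []       _       = 0
part (x ∷ _)  zero    = x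
part (_ ∷ xs) (suc i) = part xs i

mult : ℕ → List ℕ → ℕ
mult d l = length (filter (d ≟_) l)

-- Boxes are pairs (row i, column j), 0-indexed.
Box : Set
Box = ℕ × ℕ

InSkew : List ℕ → List ℕ → Box → Set
InSkew lam mu (i , j) = part mu i ≤ j × j < part lam i

Adjacent : Box → Box → Set
Adjacent (i , j) (i' , j') =
  (i ≡ i' × (suc j ≡ j' ⊎ suc j' ≡ j)) ⊎ (j ≡ j' × (suc i ≡ i' ⊎ suc i' ≡ i))

SkewAdj : List ℕ → List ℕ → Box → Box → Set
SkewAdj lam mu a b = InSkew lam mu a × InSkew lam mu b × Adjacent a b

Connected : List ℕ → List ℕ → Set
Connected lam mu = ∀ a b → InSkew lam mu a → InSkew lam mu b → Star (SkewAdj lam mu) a b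

No2x2 : List ℕ → List ℕ → Set
No2x2 lam mu = ∀ i j → ¬ (InSkew lam mu (i , j) × InSkew lam mu (suc i , j)
                          × InSkew lam mu (i , suc j) × InSkew lam mu (suc i , suc j))

RemoveRimhook : ℕ → List ℕ → List ℕ → Set
RemoveRimhook c lam mu =
  IsPartition lam × IsPartition mu
  × (∀ i → part mu i ≤ part lam i)
  × (sum lam ∸ sum mu ≡ c)
  × Connected lam mu
  × No2x2 lam mu

IsCore : ℕ → List ℕ → Set
IsCore c mu = IsPartition mu × (∀ nu → ¬ RemoveRimhook c mu nu)

HasCore : ℕ → List ℕ → List ℕ → Set
HasCore c lam mu = IsPartition lam × Star (RemoveRimhook c) lam mu × IsCore c mu

InPar : ℕ → List ℕ → List ℕ → Set
InPar c mu lam = HasCore c lam mu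

-- G_c(λ) = (ξ , ν): ξ, ν are the partitions with
-- m_d(ξ) = ⌊m_d(λ)/c⌋ and m_d(ν) = m_d(λ) - c⌊m_d(λ)/c⌋ for all d ≥ 1
-- (partitions are determined by their multiplicities).
Gc : (c : ℕ) → .{{_ : Data.Nat.NonZero c}} → List ℕ → List ℕ → List ℕ → Set
Gc c lam xi nu =
  IsPartition xi × IsPartition nu
  × (∀ d → 1 ≤ d → mult d xi ≡ mult d lam / c)
  × (∀ d → 1 ≤ d → mult d nu ≡ mult d lam ∸ c Data.Nat.* (mult d lam / c))

{-# OPTIONS --safe #-}
-- Record a partition with at most N parts by its N beta-numbers λ_i + N − 1 − i.
-- Removing a c-rimhook slides one bead from x down to the empty position x − c,
-- and deleting c equal parts removes c consecutive beads, a full set of residues;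
-- neither changes the multiset of bead positions modulo c. A c-core is exactly a
-- partition whose beads are closed under x ↦ x − c, and a closed bead set is
-- determined by its residues, each residue class filling an initial segment of
-- its runner. As m_d(ν) ≡ m_d(λ) mod c, ν arises from λ by deleting blocks of c
-- equal parts, so stripping c-rimhooks from ν ends at a core with the residues
-- of λ, which is μ.
module Submission where

open import Defs
open import Data.Nat using (ℕ; NonZero; ≢-nonZero⁻¹; >-nonZero⁻¹; zero; suc; z<s; s<s; s≤s⁻¹; _+_; _*_; _∸_; _≤_; _<_; _≥_; _>_; z≤n; s≤s; _≟_; _≤?_; _<?_; pred)
open import Data.Nat.Properties
open import Data.Nat.DivMod
open import Data.Nat.ListAction using (sum)
open import Data.Nat.ListAction.Properties using (sum-++; sum-↭)
open import Data.List using (List; []; _∷_; length; filter; map; _++_; [_]; replicate; drop; applyDownFrom; downFrom)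
open import Data.List.Relation.Unary.All using (All; []; _∷_)
import Data.List.Relation.Unary.All as All
open import Data.List.Relation.Unary.Any using (here; there)
open import Data.List.Relation.Unary.Linked using (Linked; []; [-]; _∷_)
import Data.List.Relation.Unary.Linked as Linked
open import Data.List.Membership.Propositional using (_∈_; _∉_)
open import Data.List.Membership.Propositional.Properties using (∈-map⁺; ∈-map⁻; ∈-filter⁺; ∈-filter⁻)
open import Data.List.Relation.Binary.Permutation.Propositional using (_↭_; ↭-refl; ↭-sym; ↭-trans; prep; module PermutationReasoning)
import Data.List.Relation.Binary.Permutation.Propositional.Properties as ↭
import Data.List.Properties as List
import Data.List.Relation.Unary.All.Properties as All
import Data.List.Relation.Unary.Linked.Properties as Linked
open import Data.List.Relation.Unary.AllPairs using (AllPairs; []; _∷_)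
import Data.List.Relation.Unary.AllPairs.Properties as AllPairs
open import Data.List.Membership.DecPropositional _≟_ using (_∈?_)
open import Data.Product using (_×_; _,_; proj₁; proj₂; ∃-syntax)
open import Data.Sum using (_⊎_; inj₁; inj₂)
open import Data.Empty using (⊥-elim)
open import Data.Empty.Irrelevant renaming (⊥-elim to ⊥-elim-irr)
open import Function using (_∘_)
open import Relation.Nullary using (¬_; Dec; yes; no)
open import Relation.Binary.PropositionalEquality using (_≡_; refl; sym; trans; cong; cong₂; subst; subst₂; _≢_; module ≡-Reasoning)
open import Relation.Binary.Construct.Closure.ReflexiveTransitive using (Star; ε; _◅_; _◅◅_)
import Relation.Binary.Construct.Closure.ReflexiveTransitive as Star
open import Data.Nat.Tactic.RingSolver using (solve-∀)
open import Induction.WellFounded using (Acc; acc)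
open import Data.Nat.Induction using (<-wellFounded)

range : ℕ → ℕ → List ℕ
range s zero    = []
range s (suc n) = s ∷ range (suc s) n

range-++ : ∀ s m n → range s (m + n) ≡ range s m ++ range (s + m) n
range-++ s zero    n rewrite +-identityʳ s = refl
range-++ s (suc m) n rewrite +-suc s m     = cong (s ∷_) (range-++ (suc s) m n)

range-suc : ∀ s n → range s (suc n) ≡ range s n ++ [ s + n ]
range-suc s zero    = cong [_] (sym (+-identityʳ s))
range-suc s (suc n) rewrite +-suc s n = cong (s ∷_) (range-suc (suc s) n)

map-range-suc : ∀ {A : Set} (f : ℕ → A) s n → map f (range (suc s) n) ≡ map (f ∘ suc) (range s n)
map-range-suc f s zero    = refl
map-range-suc f s (suc n) = cong (f (suc s) ∷_) (map-range-suc f (suc s) n)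

∈-range⁻ : ∀ {x} s n → x ∈ range s n → s ≤ x × x < s + n
∈-range⁻     s (suc n) (here refl) = ≤-refl , m<m+n s z<s
∈-range⁻ {x} s (suc n) (there x∈) with ∈-range⁻ (suc s) n x∈
... | s<x , x<s+n = <⇒≤ s<x , subst (x <_) (sym (+-suc s n)) x<s+n

∈-range⁺ : ∀ {x} s n → s ≤ x → x < s + n → x ∈ range s n
∈-range⁺ {x} s zero    s≤x x<s+n = ⊥-elim (<-irrefl refl (≤-<-trans s≤x (subst (x <_) (+-identityʳ s) x<s+n)))
∈-range⁺ {x} s (suc n) s≤x x<s+n with m≤n⇒m<n∨m≡n s≤x
... | inj₂ refl = here refl
... | inj₁ s<x  = there (∈-range⁺ (suc s) n s<x (subst (x <_) (+-suc s n) x<s+n))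

module _ {A : Set} (f g : ℕ → A) where

  map-cong-range : ∀ s n → (∀ i → s ≤ i → i < s + n → f i ≡ g i) → map f (range s n) ≡ map g (range s n)
  map-cong-range s zero    f≗g = refl
  map-cong-range s (suc n) f≗g =
    cong₂ _∷_ (f≗g s ≤-refl (m<m+n s z<s))
      (map-cong-range (suc s) n (λ i s<i i<s+n → f≗g i (<⇒≤ s<i) (subst (i <_) (sym (+-suc s n)) i<s+n)))

  map-cong-range⁻ : ∀ s n → map f (range s n) ≡ map g (range s n) → ∀ i → s ≤ i → i < s + n → f i ≡ g i
  map-cong-range⁻ s zero    _  i s≤i i<s+n = ⊥-elim (<-irrefl refl (≤-<-trans s≤i (subst (i <_) (+-identityʳ s) i<s+n)))
  map-cong-range⁻ s (suc n) eq i s≤i i<s+n with m≤n⇒m<n∨m≡n s≤i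
  ... | inj₂ refl = List.∷-injectiveˡ eq
  ... | inj₁ s<i  = map-cong-range⁻ (suc s) n (List.∷-injectiveʳ eq) i s<i (subst (i <_) (+-suc s n) i<s+n)

part-suc-≤ : ∀ {l} → Linked _≥_ l → ∀ i → part l (suc i) ≤ part l i
part-suc-≤ []           i       = z≤n
part-suc-≤ [-]          i       = z≤n
part-suc-≤ (x≥y ∷ _)    zero    = x≥y
part-suc-≤ (_   ∷ l≥)   (suc i) = part-suc-≤ l≥ i

part-antitone : ∀ {l} → Linked _≥_ l → ∀ {i j} → i ≤ j → part l j ≤ part l i
part-antitone {l} l≥ {i} i≤j with m≤n⇒∃[o]m+o≡n i≤j
... | k , refl = go k
  where
  go : ∀ k → part l (i + k) ≤ part l i
  go zero    rewrite +-identityʳ i = ≤-refl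
  go (suc k) rewrite +-suc i k     = ≤-trans (part-suc-≤ l≥ (i + k)) (go k)

part-≥length : ∀ l {i} → length l ≤ i → part l i ≡ 0
part-≥length []      _       = refl
part-≥length (_ ∷ l) (s≤s p) = part-≥length l p

part-injective : ∀ {l l′} → All (0 <_) l → All (0 <_) l′ → (∀ i → part l i ≡ part l′ i) → l ≡ l′
part-injective []       []       eq = refl
part-injective []       (p ∷ _)  eq = ⊥-elim (<-irrefl (eq 0) p)
part-injective (p ∷ _)  []       eq = ⊥-elim (<-irrefl (sym (eq 0)) p)
part-injective (_ ∷ ps) (_ ∷ qs) eq = cong₂ _∷_ (eq 0) (part-injective ps qs (eq ∘ suc))

part-≤⇒length-≤ : ∀ {m l} → All (0 <_) m → (∀ i → part m i ≤ part l i) → length m ≤ length l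
part-≤⇒length-≤ {m = []}                []      m≤l = z≤n
part-≤⇒length-≤ {m = _ ∷ _} {l = []}    (p ∷ _) m≤l = ⊥-elim (<-irrefl refl (<-≤-trans p (m≤l 0)))
part-≤⇒length-≤ {m = _ ∷ _} {l = _ ∷ l} (_ ∷ ps) m≤l = s≤s (part-≤⇒length-≤ {l = l} ps (m≤l ∘ suc))

part-suc-≤⇒Linked : ∀ {l} → All (0 <_) l → (∀ i → part l (suc i) ≤ part l i) → Linked _≥_ l
part-suc-≤⇒Linked {[]}        _        _ = []
part-suc-≤⇒Linked {_ ∷ []}    _        _ = [-]
part-suc-≤⇒Linked {_ ∷ _ ∷ _} (_ ∷ ps) f = f 0 ∷ part-suc-≤⇒Linked ps (f ∘ suc)

fromParts : (ℕ → ℕ) → ℕ → List ℕ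
fromParts f zero    = []
fromParts f (suc n) with f 0
... | zero  = []
... | suc k = suc k ∷ fromParts (f ∘ suc) n

fromParts-positive : ∀ f n → All (0 <_) (fromParts f n)
fromParts-positive f zero    = []
fromParts-positive f (suc n) with f 0
... | zero  = []
... | suc k = z<s ∷ fromParts-positive (f ∘ suc) n

part-fromParts : ∀ f n → (∀ i → f (suc i) ≤ f i) → (∀ i → n ≤ i → f i ≡ 0) → ∀ i → part (fromParts f n) i ≡ f i
part-fromParts f zero    f↓ f0 i = sym (f0 i z≤n)
part-fromParts f (suc n) f↓ f0 i with f 0 in f0≡
... | zero  = sym (n≤0⇒n≡0 (subst (f i ≤_) f0≡ (below0 i)))
  where
  below0 : ∀ i → f i ≤ f 0
  below0 zero    = ≤-refl
  below0 (suc i) = ≤-trans (f↓ i) (below0 i)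
part-fromParts f (suc n) f↓ f0 zero    | suc k = sym f0≡
part-fromParts f (suc n) f↓ f0 (suc i) | suc k =
  part-fromParts (f ∘ suc) n (f↓ ∘ suc) (λ i n≤i → f0 (suc i) (s≤s n≤i)) i

module BoundedSearch {P : ℕ → Set} (P? : ∀ i → Dec (P i)) where

  search : ∀ n → (∃[ i ] i < n × P i) ⊎ (∀ i → i < n → ¬ P i)
  search zero = inj₂ (λ i ())
  search (suc n) with P? n | search n
  ... | yes p | _                  = inj₁ (n , ≤-refl , p)
  ... | no _  | inj₁ (i , i<n , p) = inj₁ (i , m<n⇒m<1+n i<n , p)
  ... | no ¬p | inj₂ none          = inj₂ none′
    where
    none′ : ∀ i → i < suc n → ¬ P i
    none′ i i<1+n with m<1+n⇒m<n∨m≡n i<1+n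
    ... | inj₁ i<n  = none i i<n
    ... | inj₂ refl = ¬p

  least : ∀ {n} → (∃[ i ] i < n × P i) → ∃[ a ] a < n × P a × (∀ i → i < a → ¬ P i)
  least {suc n} (i , i<1+n , p) with search n
  ... | inj₁ below with least below
  ...   | a , a<n , pa , none = a , m<n⇒m<1+n a<n , pa , none
  least {suc n} (i , i<1+n , p) | inj₂ none with m<1+n⇒m<n∨m≡n i<1+n
  ... | inj₁ i<n  = ⊥-elim (none i i<n p)
  ... | inj₂ refl = i , ≤-refl , p , none

  greatest : ∀ {n} → (∃[ i ] i < n × P i) → ∃[ b ] b < n × P b × (∀ i → b < i → i < n → ¬ P i)
  greatest {suc n} (i , i<1+n , p) with P? n
  ... | yes pn = n , ≤-refl , pn , λ j n<j j<1+n → ⊥-elim (<-irrefl refl (<-≤-trans n<j (s≤s⁻¹ j<1+n)))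
  ... | no ¬pn with m<1+n⇒m<n∨m≡n i<1+n
  ...   | inj₂ refl = ⊥-elim (¬pn p)
  ...   | inj₁ i<n with greatest (i , i<n , p)
  ...     | b , b<n , pb , none = b , m<n⇒m<1+n b<n , pb , none′
    where
    none′ : ∀ j → b < j → j < suc n → ¬ P j
    none′ j b<j j<1+n with m<1+n⇒m<n∨m≡n j<1+n
    ... | inj₁ j<n  = none j b<j j<n
    ... | inj₂ refl = ¬pn

m<n⇒n∸m≡1+[n∸1+m] : ∀ {m n} → m < n → n ∸ m ≡ suc (n ∸ suc m)
m<n⇒n∸m≡1+[n∸1+m] {zero}  {suc n} _         = refl
m<n⇒n∸m≡1+[n∸1+m] {suc m} {suc n} (s≤s m<n) = m<n⇒n∸m≡1+[n∸1+m] m<n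

∸-suc-split : ∀ {a b N} → a ≤ b → b < N → N ∸ suc a ≡ (b ∸ a) + (N ∸ suc b)
∸-suc-split {a} a≤b b<N with m≤n⇒∃[o]m+o≡n a≤b | m≤n⇒∃[o]m+o≡n b<N
... | k , refl | r , refl = begin
  suc (a + k) + r ∸ suc a          ≡⟨ cong (_∸ suc a) (+-assoc (suc a) k r) ⟩
  suc a + (k + r) ∸ suc a          ≡⟨ m+n∸m≡n (suc a) (k + r) ⟩
  k + r                            ≡⟨ sym (cong₂ _+_ (m+n∸m≡n a k) (m+n∸m≡n (suc (a + k)) r)) ⟩
  (a + k ∸ a) + (suc (a + k) + r ∸ suc (a + k)) ∎
  where open ≡-Reasoning

bead : ℕ → List ℕ → ℕ → ℕ
bead N l i = part l i + (N ∸ suc i)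

beads : ℕ → List ℕ → List ℕ
beads N l = map (bead N l) (range 0 N)

beads-cons : ∀ N x l → beads (suc N) (x ∷ l) ≡ (x + N) ∷ beads N l
beads-cons N x l = cong (x + N ∷_) (map-range-suc (bead (suc N) (x ∷ l)) 0 N)

beads-[] : ∀ N → beads N [] ≡ downFrom N
beads-[] zero    = refl
beads-[] (suc N) = cong (N ∷_) (trans (map-range-suc (bead (suc N) []) 0 N) (beads-[] N))

sum-beads : ∀ N l → length l ≤ N → sum (beads N l) ≡ sum l + sum (downFrom N)
sum-beads N       []      _         = cong sum (beads-[] N)
sum-beads (suc N) (x ∷ l) (s≤s l≤N) = begin
  sum (beads (suc N) (x ∷ l))         ≡⟨ cong sum (beads-cons N x l) ⟩
  x + N + sum (beads N l)             ≡⟨ cong (x + N +_) (sum-beads N l l≤N) ⟩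
  x + N + (sum l + sum (downFrom N))  ≡⟨ interchange x N (sum l) (sum (downFrom N)) ⟩
  x + sum l + (N + sum (downFrom N))  ∎
  where
  open ≡-Reasoning
  interchange : ∀ a b c d → a + b + (c + d) ≡ a + c + (b + d)
  interchange = solve-∀

Linked-map-range : ∀ {R : ℕ → ℕ → Set} (f : ℕ → ℕ) s n →
  (∀ i → s ≤ i → suc i < s + n → R (f i) (f (suc i))) → Linked R (map f (range s n))
Linked-map-range f s zero                 _ = []
Linked-map-range f s (suc zero)           _ = [-]
Linked-map-range f s (suc (suc n)) R-step =
  R-step s ≤-refl (subst (suc s <_) (sym (+-suc s (suc n))) (s<s (m<m+n s z<s)))
  ∷ Linked-map-range f (suc s) (suc n) (λ i s<i i+1<s+n → R-step i (<⇒≤ s<i) (subst (suc i <_) (sym (+-suc s (suc n))) i+1<s+n))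

beads-strictlyDecreasing : ∀ N {l} → Linked _≥_ l → AllPairs _>_ (beads N l)
beads-strictlyDecreasing N {l} l≥ = Linked.Linked⇒AllPairs (λ x>y y>z → <-trans y>z x>y)
  (Linked-map-range (bead N l) 0 N (λ i _ i+1<N → begin-strict
    part l (suc i) + (N ∸ suc (suc i))  ≤⟨ +-monoˡ-≤ _ (part-suc-≤ l≥ i) ⟩
    part l i + (N ∸ suc (suc i))        <⟨ +-monoʳ-< (part l i) (n<1+n _) ⟩
    part l i + suc (N ∸ suc (suc i))    ≡⟨ cong (part l i +_) (sym (m<n⇒n∸m≡1+[n∸1+m] i+1<N)) ⟩
    part l i + (N ∸ suc i)              ∎))
  where open ≤-Reasoning

-- μ arises from λ by removing a border strip spanning the rows a … b.
record Strip (L M : ℕ → ℕ) (a b : ℕ) : Set where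
  field
    a≤b     : a ≤ b
    above   : ∀ i → i < a → M i ≡ L i
    below   : ∀ i → b < i → M i ≡ L i
    shifted : ∀ i → a ≤ i → i < b → suc (M i) ≡ L (suc i)

record ShiftDecomposition {A : Set} (f g : ℕ → A) (N a b : ℕ) : Set where
  field
    prefix middle suffix : List A
    f-split : map f (range 0 N) ≡ prefix ++ [ f a ] ++ middle ++ suffix
    g-split : map g (range 0 N) ≡ prefix ++ middle ++ [ g b ] ++ suffix

module _ {A : Set} (f g : ℕ → A) where

  map-range-shift : ∀ a k → (∀ i → a ≤ i → i < a + k → g i ≡ f (suc i)) →
    map g (range a (suc k)) ≡ map f (range (suc a) k) ++ [ g (a + k) ]
  map-range-shift a zero    _     = cong (λ i → [ g i ]) (sym (+-identityʳ a))
  map-range-shift a (suc k) g≡f∘s =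
    cong₂ _∷_ (g≡f∘s a ≤-refl (m<m+n a z<s))
      (trans (map-range-shift (suc a) k (λ i a<i i<a+k → g≡f∘s i (<⇒≤ a<i) (subst (i <_) (sym (+-suc a k)) i<a+k)))
             (cong (λ i → map f (range (suc (suc a)) k) ++ [ g i ]) (sym (+-suc a k))))

  shift-decomposition : ∀ N a b → a ≤ b → b < N →
    (∀ i → i < a → g i ≡ f i) → (∀ i → b < i → i < N → g i ≡ f i) →
    (∀ i → a ≤ i → i < b → g i ≡ f (suc i)) → ShiftDecomposition f g N a b
  shift-decomposition N a b a≤b b<N g≡f↑ g≡f↓ g≡f∘s with m≤n⇒∃[o]m+o≡n a≤b | m≤n⇒∃[o]m+o≡n b<N
  ... | k , refl | r , refl = record
    { prefix  = map f (range 0 a)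
    ; middle  = map f (range (suc a) k)
    ; suffix  = map f (range (a + suc k) r)
    ; f-split = trans (cong (map f) split)
                  (trans (List.map-++ f (range 0 a) _) (cong (map f (range 0 a) ++_) (List.map-++ f (range a (suc k)) _)))
    ; g-split = trans (cong (map g) split)
                  (trans (List.map-++ g (range 0 a) _)
                    (cong₂ _++_ (map-cong-range g f 0 a (λ i _ → g≡f↑ i))
                      (trans (List.map-++ g (range a (suc k)) _)
                        (trans (cong₂ _++_ (map-range-shift a k g≡f∘s) suffix-agrees)
                               (List.++-assoc (map f (range (suc a) k)) _ _)))))
    }
    where
    length-split : suc (a + k) + r ≡ a + (suc k + r)
    length-split = trans (cong suc (+-assoc a k r)) (sym (+-suc a (k + r)))
    split : range 0 (suc (a + k) + r) ≡ range 0 a ++ range a (suc k) ++ range (a + suc k) r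
    split = trans (cong (range 0) length-split) (trans (range-++ 0 a (suc k + r)) (cong (range 0 a ++_) (range-++ a (suc k) r)))
    suffix-agrees : map g (range (a + suc k) r) ≡ map f (range (a + suc k) r)
    suffix-agrees = map-cong-range g f (a + suc k) r (λ i a+k<i i<N →
      g≡f↓ i (subst (_≤ i) (+-suc a k) a+k<i) (subst (i <_) (trans (+-assoc a (suc k) r) (sym length-split)) i<N))

module _ {A B : Set} {f g : ℕ → A} {N a b : ℕ} (d : ShiftDecomposition f g N a b) where
  open ShiftDecomposition d

  map-shift-↭ : (h : A → B) → h (g b) ≡ h (f a) → map h (map g (range 0 N)) ↭ map h (map f (range 0 N))
  map-shift-↭ h h-eq = subst₂ _↭_ (sym (cong (map h) g-split)) (sym (cong (map h) f-split))
    (↭-trans (↭.map⁺ h (↭.++⁺ˡ prefix (↭.shift (g b) middle suffix)))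
      (subst (map h (prefix ++ g b ∷ middle ++ suffix) ↭_) swap-head ↭-refl))
    where
    swap-head : map h (prefix ++ g b ∷ middle ++ suffix) ≡ map h (prefix ++ f a ∷ middle ++ suffix)
    swap-head = trans (List.map-++ h prefix _)
      (trans (cong (λ y → map h prefix ++ y ∷ map h (middle ++ suffix)) h-eq) (sym (List.map-++ h prefix _)))

sum-shift : ∀ {f g : ℕ → ℕ} {N a b} → ShiftDecomposition f g N a b →
  sum (map g (range 0 N)) + f a ≡ sum (map f (range 0 N)) + g b
sum-shift {f} {g} {N} {a} {b} d = begin
  sum (map g (range 0 N)) + f a                          ≡⟨ cong (λ xs → sum xs + f a) g-split ⟩
  sum (prefix ++ middle ++ g b ∷ suffix) + f a           ≡⟨ cong (_+ f a) (sum-↭ (↭.++⁺ˡ prefix (↭.shift (g b) middle suffix))) ⟩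
  sum (prefix ++ g b ∷ middle ++ suffix) + f a           ≡⟨ cong (_+ f a) (sum-++ prefix _) ⟩
  sum prefix + (g b + sum (middle ++ suffix)) + f a      ≡⟨ exchange (sum prefix) (g b) (f a) (sum (middle ++ suffix)) ⟩
  sum prefix + (f a + sum (middle ++ suffix)) + g b      ≡⟨ cong (_+ g b) (sym (sum-++ prefix _)) ⟩
  sum (prefix ++ f a ∷ middle ++ suffix) + g b           ≡⟨ cong (λ xs → sum xs + g b) (sym f-split) ⟩
  sum (map f (range 0 N)) + g b                          ∎
  where
  open ≡-Reasoning
  open ShiftDecomposition d
  exchange : ∀ p u v w → p + (u + w) + v ≡ p + (v + w) + u
  exchange = solve-∀

module _ {N a b : ℕ} (a≤b : a ≤ b) (b<N : b < N) where

  private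
    bead-last : ∀ m k → bead N m b + k ≡ part m b + k + (N ∸ suc b)
    bead-last m k = right-comm (part m b) (N ∸ suc b) k
      where
      right-comm : ∀ x y z → x + y + z ≡ x + z + y
      right-comm = solve-∀

    bead-first : ∀ l → bead N l a ≡ part l a + (b ∸ a) + (N ∸ suc b)
    bead-first l = trans (cong (part l a +_) (∸-suc-split a≤b b<N)) (sym (+-assoc (part l a) _ _))

  bead-move⁺ : ∀ {l m k} → part m b + k ≡ part l a + (b ∸ a) → bead N m b + k ≡ bead N l a
  bead-move⁺ {l} {m} {k} eq = trans (bead-last m k) (trans (cong (_+ (N ∸ suc b)) eq) (sym (bead-first l)))

  bead-move⁻ : ∀ {l m k} → bead N m b + k ≡ bead N l a → part m b + k ≡ part l a + (b ∸ a)
  bead-move⁻ {l} {m} {k} eq = +-cancelʳ-≡ (N ∸ suc b) _ _ (trans (sym (bead-last m k)) (trans eq (bead-first l)))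

strip⇒shiftDecomposition : ∀ {l m a b} N → Strip (part l) (part m) a b → b < N →
  ShiftDecomposition (bead N l) (bead N m) N a b
strip⇒shiftDecomposition {l} {m} {a} {b} N s b<N = shift-decomposition (bead N l) (bead N m) N a b a≤b b<N
  (λ i i<a → cong (_+ (N ∸ suc i)) (above i i<a))
  (λ i b<i _ → cong (_+ (N ∸ suc i)) (below i b<i))
  (λ i a≤i i<b → begin
    part m i + (N ∸ suc i)                  ≡⟨ cong (part m i +_) (m<n⇒n∸m≡1+[n∸1+m] (≤-<-trans i<b b<N)) ⟩
    part m i + suc (N ∸ suc (suc i))        ≡⟨ +-suc (part m i) _ ⟩
    suc (part m i) + (N ∸ suc (suc i))      ≡⟨ cong (_+ (N ∸ suc (suc i))) (shifted i a≤i i<b) ⟩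
    part l (suc i) + (N ∸ suc (suc i))      ∎)
  where
  open Strip s
  open ≡-Reasoning

strip-sum : ∀ {l m a b} N → Strip (part l) (part m) a b → b < N → length l ≤ N → length m ≤ N →
  sum m + bead N l a ≡ sum l + bead N m b
strip-sum {l} {m} {a} {b} N s b<N l≤N m≤N = +-cancelˡ-≡ T _ _ (begin
  T + (sum m + bead N l a)                ≡⟨ swap T (sum m) (bead N l a) ⟩
  sum m + T + bead N l a                  ≡⟨ cong (_+ bead N l a) (sym (sum-beads N m m≤N)) ⟩
  sum (beads N m) + bead N l a            ≡⟨ sum-shift (strip⇒shiftDecomposition {l} {m} N s b<N) ⟩
  sum (beads N l) + bead N m b            ≡⟨ cong (_+ bead N m b) (sum-beads N l l≤N) ⟩
  sum l + T + bead N m b                  ≡⟨ sym (swap T (sum l) (bead N m b)) ⟩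
  T + (sum l + bead N m b)                ∎)
  where
  open ≡-Reasoning
  T : ℕ
  T = sum (downFrom N)
  swap : ∀ t x y → t + (x + y) ≡ x + t + y
  swap = solve-∀

module StripRows {L M : ℕ → ℕ} {a b} (s : Strip L M a b) (L-antitone : ∀ i → L (suc i) ≤ L i)
                 (last-row : M b < L b) where
  open Strip s

  row-nonempty : ∀ i → a ≤ i → i ≤ b → M i < L i
  row-nonempty i a≤i i≤b with m≤n⇒m<n∨m≡n i≤b
  ... | inj₂ refl = last-row
  ... | inj₁ i<b  = <-≤-trans (subst (M i <_) (shifted i a≤i i<b) ≤-refl) (L-antitone i)

  M≤L : ∀ i → M i ≤ L i
  M≤L i with i <? a | b <? i
  ... | yes i<a | _       = ≤-reflexive (above i i<a)
  ... | no _    | yes b<i = ≤-reflexive (below i b<i)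
  ... | no i≮a  | no b≮i  = <⇒≤ (row-nonempty i (≮⇒≥ i≮a) (≮⇒≥ b≮i))

  M-antitone : L (suc b) ≤ M b → ∀ i → M (suc i) ≤ M i
  M-antitone L[b+1]≤M[b] i with i <? a | b <? i
  ... | yes i<a | _       = subst (M (suc i) ≤_) (sym (above i i<a)) (≤-trans (M≤L (suc i)) (L-antitone i))
  ... | no _    | yes b<i = subst (M (suc i) ≤_) (sym (below i b<i)) (≤-trans (M≤L (suc i)) (L-antitone i))
  ... | no i≮a  | no b≮i with m≤n⇒m<n∨m≡n (≮⇒≥ b≮i)
  ...   | inj₂ refl = subst (_≤ M i) (sym (below (suc i) ≤-refl)) L[b+1]≤M[b]
  ...   | inj₁ i<b  = s≤s⁻¹ (subst (M (suc i) <_) (sym (shifted i (≮⇒≥ i≮a) i<b))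
                        (row-nonempty (suc i) (m≤n⇒m≤1+n (≮⇒≥ i≮a)) i<b))

Adjacent-sym : ∀ {p q} → Adjacent p q → Adjacent q p
Adjacent-sym (inj₁ (refl , inj₁ e)) = inj₁ (refl , inj₂ e)
Adjacent-sym (inj₁ (refl , inj₂ e)) = inj₁ (refl , inj₁ e)
Adjacent-sym (inj₂ (refl , inj₁ e)) = inj₂ (refl , inj₂ e)
Adjacent-sym (inj₂ (refl , inj₂ e)) = inj₂ (refl , inj₁ e)

path-crosses-row : ∀ {l m : List ℕ} {p q : Box} i → Star (SkewAdj l m) p q → proj₁ p ≤ i → i < proj₁ q →
  ∃[ j ] InSkew l m (i , j) × InSkew l m (suc i , j)
path-crosses-row i ε p≤i i<q = ⊥-elim (<-irrefl refl (≤-<-trans p≤i i<q))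
path-crosses-row {l} {m} {p = (i₀ , j₀)} i (_◅_ {j = (i₁ , _)} (p∈ , p′∈ , adj) path) i₀≤i i<q with i₁ ≤? i
... | yes i₁≤i = path-crosses-row {l} {m} i path i₁≤i i<q
... | no i₁≰i with adj
...   | inj₁ (refl , _)       = ⊥-elim (i₁≰i i₀≤i)
...   | inj₂ (refl , inj₂ refl) = ⊥-elim (i₁≰i (≤-trans (n≤1+n i₁) i₀≤i))
...   | inj₂ (refl , inj₁ refl) with ≤-antisym i₀≤i (s≤s⁻¹ (≰⇒> i₁≰i))
...     | refl = j₀ , p∈ , p′∈

module StripGeometry {l m : List ℕ} {a b} (l≥ : Linked _≥_ l) (m≥ : Linked _≥_ m)
                     (s : Strip (part l) (part m) a b) (last-row : part m b < part l b) where
  open Strip s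
  open StripRows s (part-suc-≤ l≥) last-row

  rows-of-boxes : ∀ {i j} → InSkew l m (i , j) → a ≤ i × i ≤ b
  rows-of-boxes {i} (m≤j , j<l) =
      ≮⇒≥ (λ i<a → <-irrefl refl (<-≤-trans j<l (subst (_≤ _) (above i i<a) m≤j)))
    , ≮⇒≥ (λ b<i → <-irrefl refl (<-≤-trans j<l (subst (_≤ _) (below i b<i) m≤j)))

  path-along-row : ∀ i d → d + part m i < part l i → Star (SkewAdj l m) (i , d + part m i) (i , part m i)
  path-along-row i zero    _ = ε
  path-along-row i (suc d) d+1<l =
    ((m≤n⇒m≤1+n (m≤n+m _ d) , d+1<l) , (m≤n+m _ d , <-trans (n<1+n _) d+1<l) , inj₁ (refl , inj₂ refl))
    ◅ path-along-row i d (<-trans (n<1+n _) d+1<l)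

  path-to-row-start : ∀ {i j} → InSkew l m (i , j) → Star (SkewAdj l m) (i , j) (i , part m i)
  path-to-row-start {i} (m≤j , j<l) = subst (λ j → Star (SkewAdj l m) (i , j) (i , part m i)) (m∸n+n≡m m≤j)
    (path-along-row i (_ ∸ part m i) (subst (_< part l i) (sym (m∸n+n≡m m≤j)) j<l))

  path-down : ∀ d {i j} → d + i ≡ b → InSkew l m (i , j) → Star (SkewAdj l m) (i , j) (b , part m b)
  path-down zero    refl box = path-to-row-start box
  path-down (suc d) {i} d+i≡b box =
    path-to-row-start box ◅◅ (step ◅ path-down d (trans (+-suc d i) d+i≡b) box′)
    where
    a≤i : a ≤ i
    a≤i = proj₁ (rows-of-boxes box)
    i<b : i < b
    i<b = subst (i <_) d+i≡b (s≤s (m≤n+m i d))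
    box′ : InSkew l m (suc i , part m i)
    box′ = part-suc-≤ m≥ i , subst (part m i <_) (shifted i a≤i i<b) ≤-refl
    step : SkewAdj l m (i , part m i) (suc i , part m i)
    step = (≤-refl , row-nonempty i a≤i (<⇒≤ i<b)) , box′ , inj₂ (refl , inj₁ refl)

  path-to-corner : ∀ {i j} → InSkew l m (i , j) → Star (SkewAdj l m) (i , j) (b , part m b)
  path-to-corner {i} box with m≤n⇒∃[o]m+o≡n (proj₂ (rows-of-boxes box))
  ... | d , i+d≡b = path-down d (trans (+-comm d i) i+d≡b) box

  connected : Connected l m
  connected _ _ box box′ = path-to-corner box ◅◅ Star.reverse (λ { (p , q , adj) → q , p , Adjacent-sym adj }) (path-to-corner box′)

  no2x2 : No2x2 l m
  no2x2 i j (box , box↓ , _ , box↘) = <-irrefl refl (<-≤-trans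
    (subst (suc j <_) (sym (shifted i (proj₁ (rows-of-boxes box)) (proj₂ (rows-of-boxes box↓)))) (proj₂ box↘))
    (s≤s (proj₁ box)))

-- Consecutive rows of λ / μ between two nonempty rows share exactly one column:
-- a path joins the two rows, and a second shared column would give a 2×2 square.
rows-meet-once : ∀ {l m a b} → Linked _≥_ l → Linked _≥_ m → Connected l m → No2x2 l m →
  part m a < part l a → part m b < part l b → ∀ i → a ≤ i → i < b → suc (part m i) ≡ part l (suc i)
rows-meet-once {l} {m} {a} {b} l≥ m≥ conn no2 row-a row-b i a≤i i<b
  with path-crosses-row {l} {m} i (conn (a , part m a) (b , part m b) (≤-refl , row-a) (≤-refl , row-b)) a≤i i<b
... | j , (m≤j , _) , (_ , j<l) = ≤-antisym meets (≮⇒≥ λ wider → no2 i (part m i)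
      ( (≤-refl , <-≤-trans meets (part-suc-≤ l≥ i))
      , (part-suc-≤ m≥ i , meets)
      , (n≤1+n _ , <-≤-trans wider (part-suc-≤ l≥ i))
      , (≤-trans (part-suc-≤ m≥ i) (n≤1+n _) , wider)))
  where
  meets : suc (part m i) ≤ part l (suc i)
  meets = ≤-<-trans m≤j j<l

part-≤-agree : ∀ {l m} → (∀ i → part m i ≤ part l i) →
  ∀ i → (i < length l → ¬ part m i < part l i) → part m i ≡ part l i
part-≤-agree {l} {m} m⊆l i same with i <? length l
... | yes i<l = ≤-antisym (m⊆l i) (≮⇒≥ (same i<l))
... | no  i≮l = trans (n≤0⇒n≡0 (subst (part m i ≤_) l-zero (m⊆l i))) (sym l-zero)
  where
  l-zero : part l i ≡ 0
  l-zero = part-≥length l (≮⇒≥ i≮l)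

record BorderStrip (k : ℕ) (l m : List ℕ) : Set where
  field
    a b      : ℕ
    strip    : Strip (part l) (part m) a b
    b<length : b < length l
    last-row : part m b < part l b
    size     : part m b + k ≡ part l a + (b ∸ a)

removeRimhook⇒borderStrip : ∀ {k l m} .{{_ : NonZero k}} → RemoveRimhook k l m → BorderStrip k l m
removeRimhook⇒borderStrip {k} {l} {m} ((l≥ , l>0) , (m≥ , m>0) , m⊆l , sum-diff , conn , no2)
  with BoundedSearch.search (λ i → part m i <? part l i) (length l)
... | inj₂ none = ⊥-elim (≢-nonZero⁻¹ k (trans (sym sum-diff) (trans (cong (λ m → sum l ∸ sum m) m≡l) (n∸n≡0 (sum l)))))
  where
  m≡l : m ≡ l
  m≡l = part-injective m>0 l>0 λ i → part-≤-agree {l} {m} m⊆l i λ i<l → none i i<l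
... | inj₁ some with BoundedSearch.least (λ i → part m i <? part l i) some | BoundedSearch.greatest (λ i → part m i <? part l i) some
...   | a , _ , row-a , none↑ | b , b<l , row-b , none↓ = record
  { a = a ; b = b ; b<length = b<l ; last-row = row-b
  ; strip = strip
  ; size = bead-move⁻ a≤b b<l {l} {m} {k} (+-cancelˡ-≡ (sum m) _ _ (begin
      sum m + (bead N m b + k)        ≡⟨ rearrange (sum m) (bead N m b) k ⟩
      (k + sum m) + bead N m b        ≡⟨ cong (_+ bead N m b) (sym sum-l) ⟩
      sum l + bead N m b              ≡⟨ sym (strip-sum {l} {m} N strip b<l ≤-refl m≤l) ⟩
      sum m + bead N l a              ∎))
  }
  where
  open ≡-Reasoning
  N : ℕ
  N = length l
  a≤b : a ≤ b
  a≤b = ≮⇒≥ (λ b<a → none↑ b b<a row-b)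
  strip : Strip (part l) (part m) a b
  strip = record
    { a≤b = a≤b
    ; above = λ i i<a → part-≤-agree {l} {m} m⊆l i (λ _ → none↑ i i<a)
    ; below = λ i b<i → part-≤-agree {l} {m} m⊆l i (none↓ i b<i)
    ; shifted = rows-meet-once {l} {m} l≥ m≥ conn no2 row-a row-b
    }
  m≤l : length m ≤ length l
  m≤l = part-≤⇒length-≤ {m} {l} m>0 m⊆l
  sum-l : sum l ≡ k + sum m
  sum-l = trans (sym (m∸n+n≡m sum-m≤l)) (cong (_+ sum m) sum-diff)
    where
    sum-m≤l : sum m ≤ sum l
    sum-m≤l = ≮⇒≥ (λ sum-l<m → ≢-nonZero⁻¹ k (trans (sym sum-diff) (m≤n⇒m∸n≡0 (<⇒≤ sum-l<m))))
  rearrange : ∀ s x k → s + (x + k) ≡ k + s + x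
  rearrange = solve-∀

record BeadMove (k N : ℕ) (l m : List ℕ) : Set where
  field
    a b   : ℕ
    shift : ShiftDecomposition (bead N l) (bead N m) N a b
    moved : bead N m b + k ≡ bead N l a

removeRimhook⇒beadMove : ∀ {k l m} .{{_ : NonZero k}} N → RemoveRimhook k l m → length l ≤ N → BeadMove k N l m
removeRimhook⇒beadMove {l = l} {m} N rr l≤N = record
  { a = a ; b = b
  ; shift = strip⇒shiftDecomposition {l} {m} N strip b<N
  ; moved = bead-move⁺ (Strip.a≤b strip) b<N {l} {m} size
  }
  where
  open BorderStrip (removeRimhook⇒borderStrip rr)
  b<N : b < N
  b<N = <-≤-trans b<length l≤N

Strip-resp : ∀ {L M M′ a b} → (∀ i → M i ≡ M′ i) → Strip L M a b → Strip L M′ a b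
Strip-resp M≗M′ s = record
  { a≤b = a≤b
  ; above = λ i i<a → trans (sym (M≗M′ i)) (above i i<a)
  ; below = λ i b<i → trans (sym (M≗M′ i)) (below i b<i)
  ; shifted = λ i a≤i i<b → trans (cong suc (sym (M≗M′ i))) (shifted i a≤i i<b)
  }
  where open Strip s

strip⇒removeRimhook : ∀ {k l} N {M : ℕ → ℕ} {a b} → IsPartition l → length l ≤ N → b < N →
  Strip (part l) M a b → M b < part l b → part l (suc b) ≤ M b → M b + k ≡ part l a + (b ∸ a) →
  RemoveRimhook k l (fromParts M N)
strip⇒removeRimhook {k} {l} N {M} {a} {b} (l≥ , l>0) l≤N b<N s last-row L[b+1]≤M[b] size =
  (l≥ , l>0) , (m≥ , m>0) , m⊆l , sum-diff
  , StripGeometry.connected l≥ m≥ strip′ last-row′ , StripGeometry.no2x2 l≥ m≥ strip′ last-row′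
  where
  open Strip s
  open StripRows s (part-suc-≤ l≥) last-row
  m : List ℕ
  m = fromParts M N
  part-m : ∀ i → part m i ≡ M i
  part-m = part-fromParts M N (M-antitone L[b+1]≤M[b])
    (λ i N≤i → trans (below i (<-≤-trans b<N N≤i)) (part-≥length l (≤-trans l≤N N≤i)))
  m>0 : All (0 <_) m
  m>0 = fromParts-positive M N
  m≥ : Linked _≥_ m
  m≥ = part-suc-≤⇒Linked m>0 (λ i → subst₂ _≤_ (sym (part-m (suc i))) (sym (part-m i)) (M-antitone L[b+1]≤M[b] i))
  strip′ : Strip (part l) (part m) a b
  strip′ = Strip-resp (λ i → sym (part-m i)) s
  last-row′ : part m b < part l b
  last-row′ = subst (_< part l b) (sym (part-m b)) last-row
  m⊆l : ∀ i → part m i ≤ part l i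
  m⊆l i = subst (_≤ part l i) (sym (part-m i)) (M≤L i)
  sum-diff : sum l ∸ sum m ≡ k
  sum-diff = trans (cong (_∸ sum m) sum-l) (m+n∸m≡n (sum m) k)
    where
    open ≡-Reasoning
    rearrange : ∀ s x k → s + (x + k) ≡ s + k + x
    rearrange = solve-∀
    sum-l : sum l ≡ sum m + k
    sum-l = +-cancelʳ-≡ (bead N m b) _ _ (begin
      sum l + bead N m b                ≡⟨ sym (strip-sum {l} {m} N strip′ b<N l≤N (≤-trans (part-≤⇒length-≤ {m} {l} m>0 m⊆l) l≤N)) ⟩
      sum m + bead N l a                ≡⟨ cong (sum m +_) (sym (bead-move⁺ a≤b b<N {l} {m} {k} (subst (λ x → x + k ≡ _) (sym (part-m b)) size))) ⟩
      sum m + (bead N m b + k)          ≡⟨ rearrange (sum m) (bead N m b) k ⟩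
      sum m + k + bead N m b            ∎)

-- A bead that can slide k places down into a gap t starts a strip in its row a;
-- the strip ends in the row b of the lowest bead still above t.
module MovableBead {k l N a} .{{_ : NonZero k}} (l-partition : IsPartition l) (l≤N : length l ≤ N) (a<N : a < N)
                   (k≤x : k ≤ bead N l a) (t∉beads : bead N l a ∸ k ∉ beads N l) where

  private
    L : ℕ → ℕ
    L = part l

    l≥ : Linked _≥_ l
    l≥ = proj₁ l-partition

    t : ℕ
    t = bead N l a ∸ k

    t<bead-a : t < bead N l a
    t<bead-a = subst (t <_) (m∸n+n≡m k≤x) (m<m+n t (>-nonZero⁻¹ k))

    t≢bead : ∀ i → i < N → bead N l i ≢ t
    t≢bead i i<N eq = t∉beads (subst (_∈ beads N l) eq (∈-map⁺ (bead N l) (∈-range⁺ 0 N z≤n i<N)))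

    last : ∃[ b ] b < N × t < bead N l b × (∀ i → b < i → i < N → ¬ t < bead N l i)
    last = BoundedSearch.greatest (λ i → t <? bead N l i) (a , a<N , t<bead-a)

    b : ℕ
    b = proj₁ last

    b<N : b < N
    b<N = proj₁ (proj₂ last)

    a≤b : a ≤ b
    a≤b = ≮⇒≥ (λ b<a → proj₂ (proj₂ (proj₂ last)) a b<a a<N t<bead-a)

    X : ℕ
    X = N ∸ suc b

    below-t : L (suc b) + X ≤ t
    below-t with suc b <? N
    ... | yes b+1<N = subst (_≤ t) (sym (trans (cong (L (suc b) +_) (m<n⇒n∸m≡1+[n∸1+m] b+1<N)) (+-suc (L (suc b)) _)))
                        (≤∧≢⇒< (≮⇒≥ (proj₂ (proj₂ (proj₂ last)) (suc b) ≤-refl b+1<N)) (t≢bead (suc b) b+1<N))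
    ... | no b+1≮N  = subst (_≤ t) (sym (cong₂ _+_ (part-≥length l (≤-trans l≤N (≮⇒≥ b+1≮N))) (m≤n⇒m∸n≡0 (≮⇒≥ b+1≮N)))) z≤n

    X≤t : X ≤ t
    X≤t = ≤-trans (m≤n+m X (L (suc b))) below-t

    M : ℕ → ℕ
    M i with i <? a | i <? b | b <? i
    ... | yes _ | _     | _     = L i
    ... | no _  | yes _ | _     = pred (L (suc i))
    ... | no _  | no _  | yes _ = L i
    ... | no _  | no _  | no _  = t ∸ X

    M-above : ∀ i → i < a → M i ≡ L i
    M-above i i<a with i <? a | i <? b | b <? i
    ... | yes _ | _ | _ = refl
    ... | no i≮a | _ | _ = ⊥-elim (i≮a i<a)

    M-shifted : ∀ i → a ≤ i → i < b → M i ≡ pred (L (suc i))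
    M-shifted i a≤i i<b with i <? a | i <? b | b <? i
    ... | yes i<a | _      | _ = ⊥-elim (<-irrefl refl (<-≤-trans i<a a≤i))
    ... | no _    | yes _  | _ = refl
    ... | no _    | no i≮b | _ = ⊥-elim (i≮b i<b)

    M-below : ∀ i → b < i → M i ≡ L i
    M-below i b<i with i <? a | i <? b | b <? i
    ... | yes _ | _       | _       = refl
    ... | no _  | yes i<b | _       = ⊥-elim (<-asym i<b b<i)
    ... | no _  | no _    | yes _   = refl
    ... | no _  | no _    | no b≮i  = ⊥-elim (b≮i b<i)

    M-last : M b ≡ t ∸ X
    M-last with b <? a | b <? b | b <? b
    ... | yes b<a | _       | _       = ⊥-elim (<-irrefl refl (<-≤-trans b<a a≤b))
    ... | no _    | yes b<b | _       = ⊥-elim (<-irrefl refl b<b)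
    ... | no _    | no _    | yes b<b = ⊥-elim (<-irrefl refl b<b)
    ... | no _    | no _    | no _    = refl

    last-row : M b < L b
    last-row = subst (_< L b) (sym M-last)
      (+-cancelʳ-< X (t ∸ X) (L b) (subst (_< L b + X) (sym (m∸n+n≡m X≤t)) (proj₁ (proj₂ (proj₂ last)))))

    L[b+1]≤M[b] : L (suc b) ≤ M b
    L[b+1]≤M[b] = subst (L (suc b) ≤_) (sym M-last)
      (+-cancelʳ-≤ X (L (suc b)) (t ∸ X) (subst (L (suc b) + X ≤_) (sym (m∸n+n≡m X≤t)) below-t))

    strip : Strip L M a b
    strip = record
      { a≤b = a≤b
      ; above = M-above
      ; below = M-below
      ; shifted = λ i a≤i i<b → trans (cong suc (M-shifted i a≤i i<b)) (suc-pred-pos i<b)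
      }
      where
      suc-pred-pos : ∀ {i} → i < b → suc (pred (L (suc i))) ≡ L (suc i)
      suc-pred-pos {i} i<b with L (suc i) in eq
      ... | zero  = ⊥-elim (<-irrefl refl (<-≤-trans (≤-<-trans z≤n last-row) (subst (L b ≤_) eq (part-antitone l≥ i<b))))
      ... | suc _ = refl

    size : M b + k ≡ L a + (b ∸ a)
    size = +-cancelʳ-≡ X _ _ (begin
      M b + k + X              ≡⟨ cong (λ y → y + k + X) M-last ⟩
      t ∸ X + k + X            ≡⟨ right-comm (t ∸ X) k X ⟩
      t ∸ X + X + k            ≡⟨ cong (_+ k) (m∸n+n≡m X≤t) ⟩
      t + k                    ≡⟨ m∸n+n≡m k≤x ⟩
      L a + (N ∸ suc a)        ≡⟨ cong (L a +_) (∸-suc-split a≤b b<N) ⟩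
      L a + ((b ∸ a) + X)      ≡⟨ sym (+-assoc (L a) (b ∸ a) X) ⟩
      L a + (b ∸ a) + X        ∎)
      where
      open ≡-Reasoning
      right-comm : ∀ x y z → x + y + z ≡ x + z + y
      right-comm = solve-∀

  removable : ∃[ m ] RemoveRimhook k l m
  removable = fromParts M N , strip⇒removeRimhook N l-partition l≤N b<N strip last-row L[b+1]≤M[b] size

mult-here : ∀ x l → mult x (x ∷ l) ≡ suc (mult x l)
mult-here x l = cong length (List.filter-accept (x ≟_) {x} {l} refl)

mult-there : ∀ {d x} l → d ≢ x → mult d (x ∷ l) ≡ mult d l
mult-there {d} {x} l d≢x = cong length (List.filter-reject (d ≟_) {x} {l} d≢x)

mult-++ : ∀ d xs ys → mult d (xs ++ ys) ≡ mult d xs + mult d ys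
mult-++ d xs ys = trans (cong length (List.filter-++ (d ≟_) xs ys)) (List.length-++ (filter (d ≟_) xs))

mult-replicate : ∀ x n → mult x (replicate n x) ≡ n
mult-replicate x zero    = refl
mult-replicate x (suc n) = trans (mult-here x (replicate n x)) (cong suc (mult-replicate x n))

mult-replicate-≢ : ∀ {d x} n → d ≢ x → mult d (replicate n x) ≡ 0
mult-replicate-≢ zero    d≢x = refl
mult-replicate-≢ (suc n) d≢x = trans (mult-there (replicate n _) d≢x) (mult-replicate-≢ n d≢x)

mult-absent : ∀ {d l} → All (d ≢_) l → mult d l ≡ 0
mult-absent []           = refl
mult-absent (d≢x ∷ d∉l) = trans (mult-there _ d≢x) (mult-absent d∉l)

mult>0⇒∈ : ∀ y l → 0 < mult y l → y ∈ l
mult>0⇒∈ y (x ∷ l) mult>0 with y ≟ x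
... | yes refl = here refl
... | no  y≢x  = there (mult>0⇒∈ y l (subst (0 <_) (mult-there l y≢x) mult>0))

Linked-++⁻ʳ : ∀ {R : ℕ → ℕ → Set} xs {ys} → Linked R (xs ++ ys) → Linked R ys
Linked-++⁻ʳ []       R-ys   = R-ys
Linked-++⁻ʳ (_ ∷ xs) R-x∷xs = Linked-++⁻ʳ xs (Linked.tail R-x∷xs)

head-maximum : ∀ {x l} → Linked _≥_ (x ∷ l) → All (_≤ x) (x ∷ l)
head-maximum = Linked.Linked⇒All (λ y≤x z≤y → ≤-trans z≤y y≤x) ≤-refl

∈-≤-head : ∀ {x y l} → Linked _≥_ (x ∷ l) → y ∈ x ∷ l → y ≤ x
∈-≤-head x≥ = All.lookup (head-maximum x≥)

replicate-prefix : ∀ n {x l} → Linked _≥_ l → All (_≤ x) l → n ≤ mult x l → l ≡ replicate n x ++ drop n l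
replicate-prefix zero    _  _ _ = refl
replicate-prefix (suc n) {x} {y ∷ l} y≥ (y≤x ∷ l≤x) n<mult with y ≟ x
... | yes refl = cong (y ∷_) (replicate-prefix n (Linked.tail y≥) l≤x (s≤s⁻¹ (subst (suc n ≤_) (mult-here y l) n<mult)))
... | no  y≢x  = ⊥-elim (<-irrefl (sym (mult-absent (All.map (λ z<x z≡x → <-irrefl (sym z≡x) z<x) all<x))) (<-≤-trans z<s n<mult))
  where
  all<x : All (_< x) (y ∷ l)
  all<x = All.map (λ z≤y → ≤-<-trans z≤y (≤∧≢⇒< y≤x y≢x)) (head-maximum y≥)

[1+n]%d≡[1+n%d]%d : ∀ n d .{{_ : NonZero d}} → suc n % d ≡ suc (n % d) % d
[1+n]%d≡[1+n%d]%d n d = trans (cong (λ y → suc y % d) (m≡m%n+[m/n]*n n d)) ([m+kn]%n≡m%n (suc (n % d)) (n / d) d)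

1+m≡[1+n]%d⇒m≡n%d : ∀ {m n d} .{{_ : NonZero d}} → suc m ≡ suc n % d → m ≡ n % d
1+m≡[1+n]%d⇒m≡n%d {m} {n} {d} eq with suc (n % d) <? d
... | yes n%d+1<d = suc-injective (trans eq (trans ([1+n]%d≡[1+n%d]%d n d) (m<n⇒m%n≡m n%d+1<d)))
... | no  n%d+1≮d = ⊥-elim (0≢1+n (sym (trans eq (trans ([1+n]%d≡[1+n%d]%d n d) (trans (cong (_% d) wraps) (n%n≡0 d))))))
  where
  wraps : suc (n % d) ≡ d
  wraps = ≤-antisym (m%n<n n d) (≮⇒≥ n%d+1≮d)

removeRimhook-length : ∀ {k l m} → RemoveRimhook k l m → length m ≤ length l
removeRimhook-length {l = l} {m} (_ , (_ , m>0) , m⊆l , _) = part-≤⇒length-≤ {m} {l} m>0 m⊆l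

removeRimhooks-length : ∀ {k l m} → Star (RemoveRimhook k) l m → length m ≤ length l
removeRimhooks-length ε           = ≤-refl
removeRimhooks-length (rr ◅ rrs) = ≤-trans (removeRimhooks-length rrs) (removeRimhook-length rr)

removeRimhook-sum< : ∀ {k l m} .{{_ : NonZero k}} → RemoveRimhook k l m → sum m < sum l
removeRimhook-sum< {k} (_ , _ , _ , sum-diff , _) = ≰⇒> λ sum-l≤m → ≢-nonZero⁻¹ k (trans (sym sum-diff) (m≤n⇒m∸n≡0 sum-l≤m))

beads-injective : ∀ {N m m′} → All (0 <_) m → All (0 <_) m′ → length m ≤ N → length m′ ≤ N → beads N m ≡ beads N m′ → m ≡ m′
beads-injective {N} {m} {m′} m>0 m′>0 m≤N m′≤N eq = part-injective m>0 m′>0 same-part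
  where
  same-part : ∀ i → part m i ≡ part m′ i
  same-part i with i <? N
  ... | yes i<N = +-cancelʳ-≡ (N ∸ suc i) _ _ (map-cong-range⁻ (bead N m) (bead N m′) 0 N eq i z≤n i<N)
  ... | no  i≮N = trans (part-≥length m (≤-trans m≤N (≮⇒≥ i≮N))) (sym (part-≥length m′ (≤-trans m′≤N (≮⇒≥ i≮N))))

AllPairs->-≡ : ∀ {xs ys : List ℕ} → AllPairs _>_ xs → AllPairs _>_ ys → (∀ {x} → x ∈ xs → x ∈ ys) → (∀ {y} → y ∈ ys → y ∈ xs) → xs ≡ ys
AllPairs->-≡ {[]}    {[]}    _ _ _ _ = refl
AllPairs->-≡ {[]}    {_ ∷ _} _ _ _ ys⊆xs with () ← ys⊆xs (here refl)
AllPairs->-≡ {_ ∷ _} {[]}    _ _ xs⊆ys _ with () ← xs⊆ys (here refl)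
AllPairs->-≡ {x ∷ xs} {y ∷ ys} (x>xs ∷ xs>) (y>ys ∷ ys>) xs⊆ys ys⊆xs =
  cong₂ _∷_ x≡y (AllPairs->-≡ xs> ys> (tail-⊆ x>xs y>ys x≡y xs⊆ys) (tail-⊆ y>ys x>xs (sym x≡y) ys⊆xs))
  where
  ≤-head : ∀ {x y ys} → All (y >_) ys → x ∈ y ∷ ys → x ≤ y
  ≤-head y>ys (here refl) = ≤-refl
  ≤-head y>ys (there x∈) = <⇒≤ (All.lookup y>ys x∈)
  x≡y : x ≡ y
  x≡y = ≤-antisym (≤-head y>ys (xs⊆ys (here refl))) (≤-head x>xs (ys⊆xs (here refl)))
  tail-⊆ : ∀ {x y xs ys} → All (x >_) xs → All (y >_) ys → x ≡ y →
    (∀ {z} → z ∈ x ∷ xs → z ∈ y ∷ ys) → ∀ {z} → z ∈ xs → z ∈ ys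
  tail-⊆ x>xs _ refl ⊆ z∈ with ⊆ (there z∈)
  ... | here refl = ⊥-elim (<-irrefl refl (All.lookup x>xs z∈))
  ... | there z∈ys = z∈ys

m%d≡n%d∧m<n⇒m+d≤n : ∀ {m n d} .{{_ : NonZero d}} → m % d ≡ n % d → m < n → m + d ≤ n
m%d≡n%d∧m<n⇒m+d≤n {m} {n} {d} same m<n = begin
  m + d                            ≡⟨ cong (_+ d) (m≡m%n+[m/n]*n m d) ⟩
  m % d + m / d * d + d            ≡⟨ +-assoc (m % d) _ d ⟩
  m % d + (m / d * d + d)          ≡⟨ cong (m % d +_) (+-comm (m / d * d) d) ⟩
  m % d + suc (m / d) * d          ≤⟨ +-mono-≤ (≤-reflexive same) (*-monoˡ-≤ d quotients) ⟩
  n % d + n / d * d                ≡⟨ sym (m≡m%n+[m/n]*n n d) ⟩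
  n                                ∎
  where
  open ≤-Reasoning
  quotients : m / d < n / d
  quotients = *-cancelʳ-< d (m / d) (n / d) (+-cancelˡ-< (m % d) _ _ (begin-strict
    m % d + m / d * d   ≡⟨ sym (m≡m%n+[m/n]*n m d) ⟩
    m                   <⟨ m<n ⟩
    n                   ≡⟨ m≡m%n+[m/n]*n n d ⟩
    n % d + n / d * d   ≡⟨ cong (_+ n / d * d) (sym same) ⟩
    m % d + n / d * d   ∎))

applyDownFrom-↭-range : ∀ t n → applyDownFrom (t +_) n ↭ range t n
applyDownFrom-↭-range t zero    = ↭-refl
applyDownFrom-↭-range t (suc n) = begin
  t + n ∷ applyDownFrom (t +_) n  ↭⟨ prep _ (applyDownFrom-↭-range t n) ⟩
  t + n ∷ range t n               ↭⟨ ↭.∷↭∷ʳ (t + n) (range t n) ⟩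
  range t n ++ [ t + n ]          ≡⟨ sym (range-suc t n) ⟩
  range t (suc n)                 ∎
  where open PermutationReasoning

applyDownFrom-+ : ∀ t m n → applyDownFrom (t +_) (m + n) ≡ applyDownFrom ((t + n) +_) m ++ applyDownFrom (t +_) n
applyDownFrom-+ t zero    n = refl
applyDownFrom-+ t (suc m) n =
  cong₂ _∷_ (trans (cong (t +_) (+-comm m n)) (sym (+-assoc t n m))) (applyDownFrom-+ t m n)

module Residues (c-1 : ℕ) where

  c : ℕ
  c = suc c-1

  residues : ℕ → List ℕ → List ℕ
  residues N l = map (_% c) (beads N l)

  allResidues : List ℕ
  allResidues = map (_% c) (range 0 c)

  window-rotate : ∀ s → map (_% c) (range (suc s) c) ↭ map (_% c) (range s c)
  window-rotate s = begin
    map (_% c) (range (suc s) c)                       ≡⟨ cong (map (_% c)) (range-suc (suc s) c-1) ⟩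
    map (_% c) (range (suc s) c-1 ++ [ suc s + c-1 ])  ≡⟨ List.map-++ (_% c) (range (suc s) c-1) _ ⟩
    map (_% c) (range (suc s) c-1) ++ [ (suc s + c-1) % c ]  ≡⟨ cong (λ r → map (_% c) (range (suc s) c-1) ++ [ r ]) wraps ⟩
    map (_% c) (range (suc s) c-1) ++ [ s % c ]        ↭⟨ ↭.∷↭∷ʳ (s % c) _ ⟨
    map (_% c) (range s c)                             ∎
    where
    open PermutationReasoning
    wraps : (suc s + c-1) % c ≡ s % c
    wraps = trans (cong (_% c) (sym (+-suc s c-1))) ([m+n]%n≡m%n s c)

  window-residues : ∀ s → map (_% c) (range s c) ↭ allResidues
  window-residues zero    = ↭-refl
  window-residues (suc s) = ↭-trans (window-rotate s) (window-residues s)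

  window-residues↓ : ∀ t → map (_% c) (applyDownFrom (t +_) c) ↭ allResidues
  window-residues↓ t = ↭-trans (↭.map⁺ (_% c) (applyDownFrom-↭-range t c)) (window-residues t)

  residues-cons : ∀ N x l → residues (suc N) (x ∷ l) ≡ (x + N) % c ∷ residues N l
  residues-cons N x l = cong (map (_% c)) (beads-cons N x l)

  residues-pad : ∀ N l → length l ≤ N → residues (c + N) l ↭ residues N l ++ allResidues
  residues-pad N [] _ = begin
    residues (c + N) []                                        ≡⟨ cong (map (_% c)) (trans (beads-[] (c + N)) (applyDownFrom-+ 0 c N)) ⟩
    map (_% c) (applyDownFrom (N +_) c ++ downFrom N)           ≡⟨ List.map-++ (_% c) (applyDownFrom (N +_) c) (downFrom N) ⟩
    map (_% c) (applyDownFrom (N +_) c) ++ map (_% c) (downFrom N) ↭⟨ ↭.++-comm (map (_% c) (applyDownFrom (N +_) c)) _ ⟩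
    map (_% c) (downFrom N) ++ map (_% c) (applyDownFrom (N +_) c) ↭⟨ ↭.++⁺ˡ (map (_% c) (downFrom N)) (window-residues↓ N) ⟩
    map (_% c) (downFrom N) ++ allResidues                     ≡⟨ cong (λ bs → map (_% c) bs ++ allResidues) (sym (beads-[] N)) ⟩
    residues N [] ++ allResidues                               ∎
    where open PermutationReasoning
  residues-pad (suc N) (x ∷ l) (s≤s l≤N) = begin
    residues (c + suc N) (x ∷ l)               ≡⟨ cong (λ M → residues M (x ∷ l)) (+-suc c N) ⟩
    residues (suc (c + N)) (x ∷ l)             ≡⟨ residues-cons (c + N) x l ⟩
    (x + (c + N)) % c ∷ residues (c + N) l     ≡⟨ cong (_∷ residues (c + N) l) wraps ⟩
    (x + N) % c ∷ residues (c + N) l           ↭⟨ prep _ (residues-pad N l l≤N) ⟩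
    (x + N) % c ∷ residues N l ++ allResidues  ≡⟨ cong (_++ allResidues) (sym (residues-cons N x l)) ⟩
    residues (suc N) (x ∷ l) ++ allResidues    ∎
    where
    open PermutationReasoning
    wraps : (x + (c + N)) % c ≡ (x + N) % c
    wraps = trans (cong (_% c) (trans (cong (x +_) (+-comm c N)) (sym (+-assoc x N c)))) ([m+n]%n≡m%n (x + N) c)

  residues-replicate : ∀ n x N l → residues (n + N) (replicate n x ++ l) ≡ map (_% c) (applyDownFrom ((x + N) +_) n) ++ residues N l
  residues-replicate zero    x N l = refl
  residues-replicate (suc n) x N l = trans (residues-cons (n + N) x (replicate n x ++ l))
    (cong₂ _∷_ (cong (_% c) (trans (cong (x +_) (+-comm n N)) (sym (+-assoc x N n)))) (residues-replicate n x N l))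

  removeRimhook-residues : ∀ {l m} N → RemoveRimhook c l m → length l ≤ N → residues N l ↭ residues N m
  removeRimhook-residues {l} {m} N rr l≤N =
    ↭-sym (map-shift-↭ shift (_% c) (trans (sym ([m+n]%n≡m%n (bead N m b) c)) (cong (_% c) moved)))
    where open BeadMove (removeRimhook⇒beadMove N rr l≤N)

  data DeleteBlocks : List ℕ → List ℕ → Set where
    done   : DeleteBlocks [] []
    keep   : ∀ x {l n : List ℕ} → DeleteBlocks l n → DeleteBlocks (x ∷ l) (x ∷ n)
    delete : ∀ x {l n : List ℕ} → DeleteBlocks l n → DeleteBlocks (replicate c x ++ l) n

  length-replicate-++ : ∀ (x : ℕ) l → length (replicate c x ++ l) ≡ c + length l
  length-replicate-++ x l = trans (List.length-++ (replicate c x) {l}) (cong (_+ length l) (List.length-replicate c {x}))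

  DeleteBlocks-length : ∀ {l n} → DeleteBlocks l n → length n ≤ length l
  DeleteBlocks-length done               = z≤n
  DeleteBlocks-length (keep x blocks)    = s≤s (DeleteBlocks-length blocks)
  DeleteBlocks-length (delete x {l} blocks) =
    ≤-trans (DeleteBlocks-length blocks) (subst (length l ≤_) (sym (length-replicate-++ x l)) (m≤n+m (length l) c))

  DeleteBlocks-residues : ∀ {l n} → DeleteBlocks l n → ∀ N → length l ≤ N → residues N l ↭ residues N n
  DeleteBlocks-residues done            N       _         = ↭-refl
  DeleteBlocks-residues (keep x blocks) (suc N) (s≤s l≤N) =
    subst₂ _↭_ (sym (residues-cons N x _)) (sym (residues-cons N x _)) (prep _ (DeleteBlocks-residues blocks N l≤N))
  DeleteBlocks-residues (delete x {l} {n} blocks) N l≤N =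
    subst (λ M → residues M (replicate c x ++ l) ↭ residues M n) (sym N≡c+K) (begin
      residues (c + K) (replicate c x ++ l)                         ≡⟨ residues-replicate c x K l ⟩
      map (_% c) (applyDownFrom ((x + K) +_) c) ++ residues K l      ↭⟨ ↭.++⁺ʳ (residues K l) (window-residues↓ (x + K)) ⟩
      allResidues ++ residues K l                                   ↭⟨ ↭.++⁺ˡ allResidues (DeleteBlocks-residues blocks K l≤K) ⟩
      allResidues ++ residues K n                                   ↭⟨ ↭.++-comm allResidues (residues K n) ⟩
      residues K n ++ allResidues                                   ↭⟨ residues-pad K n (≤-trans (DeleteBlocks-length blocks) l≤K) ⟨
      residues (c + K) n                                            ∎)
    where
    open PermutationReasoning
    K : ℕ
    K = N ∸ c
    c+l≤N : c + length l ≤ N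
    c+l≤N = subst (_≤ N) (length-replicate-++ x l) l≤N
    l≤K : length l ≤ K
    l≤K = m+n≤o⇒m≤o∸n (length l) (subst (_≤ N) (+-comm c (length l)) c+l≤N)
    N≡c+K : N ≡ c + K
    N≡c+K = sym (m+[n∸m]≡n (≤-trans (m≤m+n c (length l)) c+l≤N))

  private
    ModMultiplicities : List ℕ → List ℕ → Set
    ModMultiplicities l n = ∀ d → mult d n ≡ mult d l % c

    mod-multiplicities-keep : ∀ {x l n} → ModMultiplicities (x ∷ l) (x ∷ n) → ModMultiplicities l n
    mod-multiplicities-keep {x} {l} {n} eq d with d ≟ x
    ... | yes refl = 1+m≡[1+n]%d⇒m≡n%d {mult d n} {mult d l} {c} (trans (sym (mult-here d n)) (trans (eq d) (cong (_% c) (mult-here d l))))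
    ... | no  d≢x  = trans (sym (mult-there n d≢x)) (trans (eq d) (cong (_% c) (mult-there l d≢x)))

    mod-multiplicities-delete : ∀ {x l n} → ModMultiplicities (replicate c x ++ l) n → ModMultiplicities l n
    mod-multiplicities-delete {x} {l} eq d with d ≟ x
    ... | yes refl = trans (eq d) (trans (cong (_% c) (trans (mult-++ d (replicate c d) l) (cong (_+ mult d l) (mult-replicate d c))))
                       (trans (cong (_% c) (+-comm c (mult d l))) ([m+n]%n≡m%n (mult d l) c)))
    ... | no  d≢x  = trans (eq d) (cong (_% c) (trans (mult-++ d (replicate c x) l) (cong (_+ mult d l) (mult-replicate-≢ c d≢x))))

    heads-agree : ∀ {x y l n} → Linked _≥_ (x ∷ l) → Linked _≥_ (y ∷ n) →
      ModMultiplicities (x ∷ l) (y ∷ n) → 0 < mult x (y ∷ n) → y ≡ x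
    heads-agree {x} {y} {l} {n} x≥ y≥ eq x∈n = ≤-antisym (∈-≤-head x≥ y∈l) (∈-≤-head y≥ (mult>0⇒∈ x (y ∷ n) x∈n))
      where
      positive : ∀ m → m % c ≢ 0 → 0 < m
      positive zero    m%c≢0 = ⊥-elim (m%c≢0 refl)
      positive (suc m) _     = z<s
      y∈l : y ∈ x ∷ l
      y∈l = mult>0⇒∈ y (x ∷ l) (positive _ (subst (_≢ 0) (trans (sym (mult-here y n)) (eq y)) λ ()))

  mod-multiplicities⇒DeleteBlocks : ∀ bound {l n} → length l ≤ bound → IsPartition l → IsPartition n →
    ModMultiplicities l n → DeleteBlocks l n
  mod-multiplicities⇒DeleteBlocks _ {[]} {[]}    _ _ _ _  = done
  mod-multiplicities⇒DeleteBlocks _ {[]} {y ∷ n} _ _ _ eq = ⊥-elim (0≢1+n (sym (trans (sym (mult-here y n)) (eq y))))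
  mod-multiplicities⇒DeleteBlocks (suc bound) {x ∷ l} {n} _ _ _ _ with mult x n in x∈n
  mod-multiplicities⇒DeleteBlocks (suc bound) {x ∷ l} {[]} _ _ _ _ | suc _ with () ← x∈n
  mod-multiplicities⇒DeleteBlocks (suc bound) {x ∷ l} {y ∷ n} (s≤s l≤bound) (x≥ , x>0) (y≥ , y>0) eq | suc _
    with heads-agree x≥ y≥ eq (subst (0 <_) (sym x∈n) z<s)
  ... | refl = keep x (mod-multiplicities⇒DeleteBlocks bound l≤bound (Linked.tail x≥ , All.tail x>0)
                         (Linked.tail y≥ , All.tail y>0) (mod-multiplicities-keep {x} {l} {n} eq))
  mod-multiplicities⇒DeleteBlocks (suc bound) {x ∷ l} {n} (s≤s l≤bound) (x≥ , x>0) n-partition eq | zero =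
    subst (λ l → DeleteBlocks l n) (sym l≡block) (delete x (mod-multiplicities⇒DeleteBlocks bound rest≤bound
      (rest≥ , rest>0) n-partition (mod-multiplicities-delete {x} {rest} {n} (subst (λ l → ModMultiplicities l n) l≡block eq))))
    where
    rest : List ℕ
    rest = drop c (x ∷ l)
    c≤mult : c ≤ mult x (x ∷ l)
    c≤mult = ≮⇒≥ λ mult<c → 0≢1+n (trans (sym x∈n) (trans (eq x) (trans (m<n⇒m%n≡m mult<c) (mult-here x l))))
    l≡block : x ∷ l ≡ replicate c x ++ rest
    l≡block = replicate-prefix c x≥ (head-maximum x≥) c≤mult
    rest≥ : Linked _≥_ rest
    rest≥ = Linked-++⁻ʳ (replicate c x) (subst (Linked _≥_) l≡block x≥)
    rest>0 : All (0 <_) rest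
    rest>0 = All.++⁻ʳ (replicate c x) (subst (All (0 <_)) l≡block x>0)
    rest≤bound : length rest ≤ bound
    rest≤bound = s≤s⁻¹ (≤-trans (subst (suc (length rest) ≤_) (sym (trans (cong length l≡block) (length-replicate-++ x rest)))
                   (+-monoˡ-≤ (length rest) (s≤s z≤n))) (s≤s l≤bound))

  Gc⇒DeleteBlocks : ∀ {lam xi nu} → IsPartition lam → IsPartition nu → Gc c lam xi nu → DeleteBlocks lam nu
  Gc⇒DeleteBlocks {lam} {xi} {nu} (lam≥ , lam>0) (nu≥ , nu>0) (_ , _ , _ , mult-nu) =
    mod-multiplicities⇒DeleteBlocks (length lam) ≤-refl (lam≥ , lam>0) (nu≥ , nu>0) mod-mult
    where
    no-zeros : ∀ {l} → All (0 <_) l → mult 0 l ≡ 0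
    no-zeros l>0 = mult-absent (All.map (λ x>0 0≡x → <-irrefl 0≡x x>0) l>0)
    mod-mult : ModMultiplicities lam nu
    mod-mult zero    = trans (no-zeros nu>0) (cong (_% c) (sym (no-zeros lam>0)))
    mod-mult (suc d) = trans (mult-nu (suc d) (s≤s z≤n))
      (trans (cong (mult (suc d) lam ∸_) (*-comm c (mult (suc d) lam / c))) (sym (m%n≡m∸m/n*n (mult (suc d) lam) c)))

  removeRimhooks-residues : ∀ {l m} N → Star (RemoveRimhook c) l m → length l ≤ N → residues N l ↭ residues N m
  removeRimhooks-residues N ε          _   = ↭-refl
  removeRimhooks-residues N (rr ◅ rrs) l≤N =
    ↭-trans (removeRimhook-residues N rr l≤N) (removeRimhooks-residues N rrs (≤-trans (removeRimhook-length rr) l≤N))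

  Closed : List ℕ → Set
  Closed B = ∀ x → x ∈ B → c ≤ x → x ∸ c ∈ B

  closed? : ∀ B → Closed B ⊎ (∃[ x ] x ∈ B × c ≤ x × x ∸ c ∉ B)
  closed? B = check B
    where
    check : ∀ xs → (∀ x → x ∈ xs → c ≤ x → x ∸ c ∈ B) ⊎ (∃[ x ] x ∈ xs × c ≤ x × x ∸ c ∉ B)
    check [] = inj₁ λ _ ()
    check (y ∷ xs) with c ≤? y | check xs
    ... | _      | inj₂ (x , x∈ , c≤x , x-c∉) = inj₂ (x , there x∈ , c≤x , x-c∉)
    ... | no c≰y | inj₁ rest                   = inj₁ λ { x (here refl) c≤x → ⊥-elim (c≰y c≤x) ; x (there x∈) → rest x x∈ }
    ... | yes c≤y | inj₁ rest with y ∸ c ∈? B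
    ...   | no  y-c∉ = inj₂ (y , here refl , c≤y , y-c∉)
    ...   | yes y-c∈ = inj₁ λ { x (here refl) _ → y-c∈ ; x (there x∈) → rest x x∈ }

  gap⇒removeRimhook : ∀ {l N} → IsPartition l → length l ≤ N →
    (∃[ x ] x ∈ beads N l × c ≤ x × x ∸ c ∉ beads N l) → ∃[ m ] RemoveRimhook c l m
  gap⇒removeRimhook {l} {N} l-partition l≤N (x , x∈ , c≤x , x-c∉) with ∈-map⁻ (bead N l) x∈
  ... | a , a∈ , refl = MovableBead.removable l-partition l≤N (proj₂ (∈-range⁻ 0 N a∈)) c≤x x-c∉

  core⇒closed : ∀ {mu} N → IsCore c mu → length mu ≤ N → Closed (beads N mu)
  core⇒closed {mu} N (mu-partition , no-rimhook) mu≤N with closed? (beads N mu)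
  ... | inj₁ closed = closed
  ... | inj₂ gap    = ⊥-elim (no-rimhook _ (proj₂ (gap⇒removeRimhook mu-partition mu≤N gap)))

  record ClosedReduction (N : ℕ) (l : List ℕ) : Set where
    field
      core      : List ℕ
      steps     : Star (RemoveRimhook c) l core
      partition : IsPartition core
      closed    : Closed (beads N core)

  reduce : ∀ {N} l → IsPartition l → length l ≤ N → Acc _<_ (sum l) → ClosedReduction N l
  reduce {N} l l-partition l≤N (acc smaller) with closed? (beads N l)
  ... | inj₁ closed = record { core = l ; steps = ε ; partition = l-partition ; closed = closed }
  ... | inj₂ gap    = reduce-step (gap⇒removeRimhook l-partition l≤N gap)
    where
    reduce-step : ∃[ m ] RemoveRimhook c l m → ClosedReduction N l
    reduce-step (m , rr) = record { core = core ; steps = rr ◅ steps ; partition = partition ; closed = closed }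
      where
      open ClosedReduction (reduce m (proj₁ (proj₂ rr)) (≤-trans (removeRimhook-length rr) l≤N) (smaller (removeRimhook-sum< rr)))

  progression : ℕ → ℕ → List ℕ
  progression r zero    = []
  progression r (suc k) = r + k * c ∷ progression r k

  private
    ∸-< : ∀ {y} → c ≤ y → y ∸ c < y
    ∸-< = ∸-monoʳ-< z<s

    progression-head : ∀ {r y} B → All (y >_) B → AllPairs _>_ B → y % c ≡ r → All (λ z → z % c ≡ r) B →
      (c ≤ y → y ∸ c ∈ y ∷ B) → B ≡ progression r (length B) → y ≡ r + length B * c
    progression-head {r} {y} B y>B B> y≡r B≡r closed B≡prog with c ≤? y
    progression-head [] _ _ y≡r _ _ _ | no c≰y = trans (sym (m<n⇒m%n≡m (≰⇒> c≰y))) (trans y≡r (sym (+-identityʳ _)))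
    progression-head (z ∷ _) (y>z ∷ _) _ y≡r (z≡r ∷ _) _ _ | no c≰y = ⊥-elim (<-irrefl z≡y y>z)
      where
      z≡y : z ≡ _
      z≡y = trans (sym (m<n⇒m%n≡m (<-trans y>z (≰⇒> c≰y)))) (trans z≡r (trans (sym y≡r) (m<n⇒m%n≡m (≰⇒> c≰y))))
    progression-head [] _ _ _ _ closed _ | yes c≤y with closed c≤y
    ... | here y-c≡y = ⊥-elim (<-irrefl y-c≡y (∸-< c≤y))
    progression-head {r} {y} (z ∷ B′) (y>z ∷ _) (z>B′ ∷ _) y≡r (z≡r ∷ _) closed B≡prog | yes c≤y = begin
      y                        ≡⟨ ≤-antisym y≤z+c (m%d≡n%d∧m<n⇒m+d≤n (trans z≡r (sym y≡r)) y>z) ⟩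
      z + c                    ≡⟨ cong (_+ c) (List.∷-injectiveˡ B≡prog) ⟩
      r + length B′ * c + c    ≡⟨ step (length B′) ⟩
      r + suc (length B′) * c  ∎
      where
      open ≡-Reasoning
      step : ∀ k → r + k * c + c ≡ r + suc k * c
      step k = trans (+-assoc r (k * c) c) (cong (r +_) (+-comm (k * c) c))
      y-c≤z : y ∸ c ≤ z
      y-c≤z with closed c≤y
      ... | here y-c≡y          = ⊥-elim (<-irrefl y-c≡y (∸-< c≤y))
      ... | there (here y-c≡z)  = ≤-reflexive y-c≡z
      ... | there (there y-c∈) = <⇒≤ (All.lookup z>B′ y-c∈)
      y≤z+c : y ≤ z + c
      y≤z+c = subst (_≤ z + c) (m∸n+n≡m c≤y) (+-monoˡ-≤ c y-c≤z)

  closed-runner : ∀ r B → AllPairs _>_ B → All (λ y → y % c ≡ r) B → Closed B → B ≡ progression r (length B)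
  closed-runner r []      _          _           _      = refl
  closed-runner r (y ∷ B) (y>B ∷ B>) (y≡r ∷ B≡r) closed =
    cong₂ _∷_ (progression-head B y>B B> y≡r B≡r (closed y (here refl)) B≡progression) B≡progression
    where
    closed-tail : Closed B
    closed-tail z z∈ c≤z with closed z (there z∈) c≤z
    ... | here z-c≡y  = ⊥-elim (<-irrefl z-c≡y (<-trans (∸-< c≤z) (All.lookup y>B z∈)))
    ... | there z-c∈ = z-c∈
    B≡progression : B ≡ progression r (length B)
    B≡progression = closed-runner r B B> B≡r closed-tail

  runner : ℕ → List ℕ → List ℕ
  runner r = filter (λ y → y % c ≟ r)

  length-runner : ∀ r B → length (runner r B) ≡ length (filter (_≟ r) (map (_% c) B))
  length-runner r []      = refl
  length-runner r (y ∷ B) with y % c ≟ r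
  ... | yes y≡r = trans (cong length (List.filter-accept (λ y → y % c ≟ r) {y} {B} y≡r))
                    (trans (cong suc (length-runner r B)) (sym (cong length (List.filter-accept (_≟ r) {y % c} {map (_% c) B} y≡r))))
  ... | no  y≢r = trans (cong length (List.filter-reject (λ y → y % c ≟ r) {y} {B} y≢r))
                    (trans (length-runner r B) (sym (cong length (List.filter-reject (_≟ r) {y % c} {map (_% c) B} y≢r))))

  runner-closed : ∀ r {B} → Closed B → Closed (runner r B)
  runner-closed r closed y y∈ c≤y with ∈-filter⁻ (λ y → y % c ≟ r) y∈
  ... | y∈B , y≡r = ∈-filter⁺ (λ y → y % c ≟ r) (closed y y∈B c≤y) (trans (m≤n⇒[n∸m]%m≡n%m c≤y) y≡r)

  runner-progression : ∀ r {B} → AllPairs _>_ B → Closed B → runner r B ≡ progression r (length (runner r B))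
  runner-progression r {B} B> closed = closed-runner r (runner r B)
    (AllPairs.filter⁺ (λ y → y % c ≟ r) B>) (All.all-filter (λ y → y % c ≟ r) B) (runner-closed r closed)

  closed-determined : ∀ {B B′} → AllPairs _>_ B → AllPairs _>_ B′ → Closed B → Closed B′ →
    map (_% c) B ↭ map (_% c) B′ → B ≡ B′
  closed-determined {B} {B′} B> B′> closed closed′ same-residues =
    AllPairs->-≡ B> B′> (runners-⊆ same-runner) (runners-⊆ (sym ∘ same-runner))
    where
    same-runner : ∀ r → runner r B ≡ runner r B′
    same-runner r = begin
      runner r B                                 ≡⟨ runner-progression r B> closed ⟩
      progression r (length (runner r B))        ≡⟨ cong (progression r) same-length ⟩
      progression r (length (runner r B′))       ≡⟨ sym (runner-progression r B′> closed′) ⟩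
      runner r B′                                ∎
      where
      open ≡-Reasoning
      same-length : length (runner r B) ≡ length (runner r B′)
      same-length = trans (length-runner r B)
        (trans (↭.↭-length (↭.filter-↭ (_≟ r) same-residues)) (sym (length-runner r B′)))
    runners-⊆ : ∀ {X Y} → (∀ r → runner r X ≡ runner r Y) → ∀ {x} → x ∈ X → x ∈ Y
    runners-⊆ same {x} x∈ = proj₁ (∈-filter⁻ (λ y → y % c ≟ x % c)
      (subst (x ∈_) (same (x % c)) (∈-filter⁺ (λ y → y % c ≟ x % c) x∈ refl)))

  closed-beads-determined : ∀ {N m m′} → IsPartition m → IsPartition m′ → length m ≤ N → length m′ ≤ N →
    Closed (beads N m) → Closed (beads N m′) → residues N m ↭ residues N m′ → m ≡ m′
  closed-beads-determined {N} (m≥ , m>0) (m′≥ , m′>0) m≤N m′≤N closed closed′ same-residues =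
    beads-injective m>0 m′>0 m≤N m′≤N
      (closed-determined (beads-strictlyDecreasing N m≥) (beads-strictlyDecreasing N m′≥) closed closed′ same-residues)

proposition2p40 : (c : ℕ) → .{{_ : NonZero c}} → (mu : List ℕ) → IsCore c mu →
    (lam xi nu : List ℕ) → InPar c mu lam → Gc c lam xi nu → InPar c mu nu
proposition2p40 zero {{c≢0}} _ _ _ _ _ _ _ = ⊥-elim-irr (NonZero.nonZero c≢0)
proposition2p40 (suc c-1) mu mu-core lam xi nu (lam-partition , lam→mu , _) G =
  nu-partition , subst (Star (RemoveRimhook (suc c-1)) nu) core≡mu steps , mu-core
  where
  open Residues c-1
  nu-partition : IsPartition nu
  nu-partition = proj₁ (proj₂ G)
  N : ℕ
  N = length lam
  blocks : DeleteBlocks lam nu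
  blocks = Gc⇒DeleteBlocks lam-partition nu-partition G
  nu≤N : length nu ≤ N
  nu≤N = DeleteBlocks-length blocks
  open ClosedReduction (reduce nu nu-partition nu≤N (<-wellFounded (sum nu)))
  mu≤N : length mu ≤ N
  mu≤N = removeRimhooks-length lam→mu
  core≡mu : core ≡ mu
  core≡mu = closed-beads-determined partition (proj₁ mu-core) (≤-trans (removeRimhooks-length steps) nu≤N) mu≤N
    closed (core⇒closed N mu-core mu≤N) (begin
      residues N core  ↭⟨ removeRimhooks-residues N steps nu≤N ⟨
      residues N nu    ↭⟨ DeleteBlocks-residues blocks N ≤-refl ⟨
      residues N lam   ↭⟨ removeRimhooks-residues N lam→mu ≤-refl ⟩
      residues N mu    ∎)
    where open PermutationReasoning
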